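{- Let $Y'\in\overline{\mathcal{Y}}$ with its pointer $\varepsilon$ visible, and let $v\in V(Y')$. Then $v$ can be written as $u$ or as $u\bullet t$ with $u\in\Pi^*$ and $t\in\{lm,rm\}^*$; in the second case $v$ is invisible. Moreover, for all $s,t\in\{lm,rm\}^*$, the paths $\bullet s$ and $\bullet t$ are vertices of $Y'$, and $\bullet s$ and $\bullet t$ designate the same vertex of $Y'$ if and only if $s=t$.
   Context: Fix finite sets $\pi$ (ports), $\Sigma,\Delta$ (labels), with $m\notin\Sigma$, $m,l,r\notin\pi$; $\Pi=\pi^2$. A graph has an at most countable vertex set, edges $\{u:a,v:b\}$ (unordered, $a,b$ ports) with each vertex–port pair in at most one edge, partial vertex and edge labels, and is connected. Pointed graphs modulo are isomorphism classes of pointed graphs under renamings preserving edges, ports, labels and pointer. In a pointed graph modulo $X$, vertices are designated by paths (words of port pairs $ab$, "leave by $a$, arrive by $b$", from the pointer), identified when reaching the same vertex; $V(X)$ is the vertex set, $\varepsilon$ the pointer, "." concatenation; the disk $X^r$ is the pointed graph modulo of the subgraph induced by vertices at distance $\le r+1$ from the pointer, with labels kept only on vertices at distance $\le r$ and edges between them. Let $\mathcal{X}'=\mathcal{X}_{\Sigma\cup\{m\},\Delta,\pi\cup\{m,l,r\}}$. $T$ is the infinite rooted binary tree, all vertices labelled $m$, each vertex linked through port $l$ (resp. $r$) to port $m$ of its left (resp. right) child. Each pointed graph modulo with ports $\pi$, labels $\Sigma,\Delta$ is identified with the element of $\mathcal{X}'$ obtained by attaching to each vertex $v$ a copy of $T$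 whose root's port $m$ is linked to port $m$ of $v$; $\mathcal{Y}$ is the set of such graphs pointed at any vertex. A vertex is invisible if labelled $m$, visible otherwise. $\bullet$ denotes the path $mm$ (so $\bullet t = mm.t$). $\overline{\mathcal{Y}}$ is the set of $Y'\in\mathcal{X}'$ such that for every $r$ there is $Y\in\mathcal{Y}$ with $Y^r=Y'^r$. -}

module Defs where

open import Data.Nat using (ℕ; zero; suc; _≤_)
open import Data.Fin using (Fin)
open import Data.Bool using (Bool; true; false)
open import Data.List using (List; []; _∷_; length; map; _++_)
open import Data.Product using (Σ; ∃; ∃-syntax; _×_; _,_; proj₁)
open import Data.Sum using (_⊎_; inj₁; inj₂)
open import Data.Unit using (⊤; tt)
open import Relation.Nullary using (¬_)
open import Relation.Binary.PropositionalEquality using (_≡_)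
open import Function.Bundles using (_↔_; Inverse; _⇔_)
open import Function.Definitions using (Injective)

-- Edges {u:a, v:b} are represented by a (symmetric) relation E u a v b;
-- partial labellings are represented by functional relations.

record Structure (Port VL EL : Set) : Set₁ where
  field
    V    : Set
    E    : V → Port → V → Port → Set
    vlab : V → VL → Set
    elab : V → Port → V → Port → EL → Set

module _ {Port VL EL : Set} (X : Structure Port VL EL) where
  open Structure X

  data Follow : V → List (Port × Port) → V → Set where
    here : ∀ {x} → Follow x [] x
    step : ∀ {x y z a b w} → E x a y b → Follow y w z → Follow x ((a , b) ∷ w) z

  record IsGraph : Set where
    field
      countable : Σ (V → ℕ) (Injective _≡_ _≡_)
      E-sym     : ∀ {u a v b} → E u a v b → E v b u a
      E-fun     : ∀ {u a v b v' b'} → E u a v b → E u a v' b' → (v ≡ v') × (b ≡ b')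
      vlab-fun  : ∀ {x σ σ'} → vlab x σ → vlab x σ' → σ ≡ σ'
      elab-E    : ∀ {u a v b δ} → elab u a v b δ → E u a v b
      elab-sym  : ∀ {u a v b δ} → elab u a v b δ → elab v b u a δ
      elab-fun  : ∀ {u a v b δ δ'} → elab u a v b δ → elab u a v b δ' → δ ≡ δ'
      connected : ∀ x y → ∃[ w ] Follow x w y

record Pointed (Port VL EL : Set) : Set₁ where
  field
    S   : Structure Port VL EL
    ptr : Structure.V S

module _ {Port VL EL : Set} where

  record _≅_ (X Y : Pointed Port VL EL) : Set where
    open Pointed X renaming (S to SX; ptr to pX)
    open Pointed Y renaming (S to SY; ptr to pY)
    open Structure SX renaming (V to VX; E to EX; vlab to lX; elab to elX)
    open Structure SY renaming (V to VY; E to EY; vlab to lY; elab to elY)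
    field
      bij    : VX ↔ VY
    f : VX → VY
    f = Inverse.to bij
    field
      pres-E    : ∀ x a y b → EX x a y b ⇔ EY (f x) a (f y) b
      pres-vlab : ∀ x σ → lX x σ ⇔ lY (f x) σ
      pres-elab : ∀ x a y b δ → elX x a y b δ ⇔ elY (f x) a (f y) b δ
      pres-ptr  : f pX ≡ pY

  module _ (X : Pointed Port VL EL) where
    open Pointed X
    open Structure S

    Within : ℕ → V → Set
    Within k x = ∃[ w ] (length w ≤ k × Follow S ptr w x)

    disk : ℕ → Pointed Port VL EL
    disk r = record
      { S = record
          { V    = Σ V (Within (suc r))
          ; E    = λ x a y b → E (proj₁ x) a (proj₁ y) b
          ; vlab = λ x σ → vlab (proj₁ x) σ × Within r (proj₁ x)
          ; elab = λ x a y b δ → elab (proj₁ x) a (proj₁ y) b δ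
                                   × Within r (proj₁ x) × Within r (proj₁ y)
          }
      ; ptr = ptr , [] , Data.Nat.z≤n , here
      }

-- Concrete setting: π = Fin nπ, Σ = Fin nΣ, Δ = Fin nΔ.

data Extra : Set where
  pm pl pr : Extra

Port' : ℕ → Set
Port' nπ = Fin nπ ⊎ Extra

VL' : ℕ → Set
VL' nΣ = Fin nΣ ⊎ ⊤

mLabel : ∀ {nΣ} → VL' nΣ
mLabel = inj₂ tt

BaseGraph : ℕ → ℕ → ℕ → Set₁
BaseGraph nπ nΣ nΔ = Σ (Structure (Fin nπ) (Fin nΣ) (Fin nΔ)) IsGraph

-- Attaching a copy of T to every vertex.  Vertex (v , w) of the tree
-- attached to v is the node reached from the root by the reversed word w
-- (false = left child, true = right child).
module _ {nπ nΣ nΔ : ℕ} (G : Structure (Fin nπ) (Fin nΣ) (Fin nΔ)) where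
  open Structure G

  AV : Set
  AV = V ⊎ (V × List Bool)

  childPort : Bool → Extra
  childPort false = pl
  childPort true  = pr

  data AE : AV → Port' nπ → AV → Port' nπ → Set where
    base    : ∀ {u a v b} → E u a v b → AE (inj₁ u) (inj₁ a) (inj₁ v) (inj₁ b)
    root→   : ∀ {v} → AE (inj₁ v) (inj₂ pm) (inj₂ (v , [])) (inj₂ pm)
    root←   : ∀ {v} → AE (inj₂ (v , [])) (inj₂ pm) (inj₁ v) (inj₂ pm)
    child→  : ∀ {v w} c → AE (inj₂ (v , w)) (inj₂ (childPort c)) (inj₂ (v , c ∷ w)) (inj₂ pm)
    child←  : ∀ {v w} c → AE (inj₂ (v , c ∷ w)) (inj₂ pm) (inj₂ (v , w)) (inj₂ (childPort c))

  data AL : AV → VL' nΣ → Set where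
    baseL : ∀ {v σ} → vlab v σ → AL (inj₁ v) (inj₁ σ)
    treeL : ∀ {t} → AL (inj₂ t) mLabel

  data AEL : AV → Port' nπ → AV → Port' nπ → Fin nΔ → Set where
    baseEL : ∀ {u a v b δ} → elab u a v b δ → AEL (inj₁ u) (inj₁ a) (inj₁ v) (inj₁ b) δ

  attach : Structure (Port' nπ) (VL' nΣ) (Fin nΔ)
  attach = record { V = AV ; E = AE ; vlab = AL ; elab = AEL }

X' : ℕ → ℕ → ℕ → Set₁
X' nπ nΣ nΔ = Pointed (Port' nπ) (VL' nΣ) (Fin nΔ)

IsGraphP : ∀ {nπ nΣ nΔ} → X' nπ nΣ nΔ → Set
IsGraphP Y = IsGraph (Pointed.S Y)

-- Y' ∈ 𝒴‾ : every disk of Y' is the disk of some Y ∈ 𝒴.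
InYbar : ∀ {nπ nΣ nΔ} → X' nπ nΣ nΔ → Set₁
InYbar {nπ} {nΣ} {nΔ} Y' =
  ∀ r → Σ (BaseGraph nπ nΣ nΔ) λ G → Σ (AV (proj₁ G)) λ q →
     disk (record { S = attach (proj₁ G) ; ptr = q }) r ≅ disk Y' r

liftΠ : ∀ {nπ} → List (Fin nπ × Fin nπ) → List (Port' nπ × Port' nπ)
liftΠ = map (λ { (a , b) → (inj₁ a , inj₁ b) })

bullet : ∀ {nπ} → Port' nπ × Port' nπ
bullet = (inj₂ pm , inj₂ pm)

treeWord : ∀ {nπ} → List Bool → List (Port' nπ × Port' nπ)
treeWord = map (λ c → (inj₂ (childPort' c) , inj₂ pm))
  where
  childPort' : Bool → Extra
  childPort' false = pl
  childPort' true  = pr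

-- Every disk of Y' is the disk of an attached graph A = attach G.  The
-- disk of radius r determines which words of length ≤ r+1 are paths from
-- the pointer, and which vertices within distance r carry which label
-- (DiskTransport).  Since labels are preserved, the pointer of A is a
-- base vertex of G, so every path of Y' from its pointer is a path of some
-- A from a base vertex, and conversely.  In A the shape of such paths is
-- explicit: Π-words stay in G, the step • enters the root of a tree, the
-- words {lm,rm}* descend in it and their reversals climb back
-- (Attached).  The four claims follow:
--   * the vertices reached by normal-form words are closed under taking
--     neighbours (the last edge of a path is read off in some A), so by
--     connectedness every vertex has a normal form;
--   * u•t reaches a tree vertex of A, which is labelled m, hence so is
--     the vertex it reaches in Y';
--   * •s is a path in A, hence in Y';
--   * if •s and •t meet in Y', then •s followed by the reversal of •t is
--     a path in some A, which forces reverse s ≡ reverse t.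

module Submission where

open import Defs
open import Data.Nat using (ℕ; suc; _+_; _≤_; z≤n)
open import Data.Nat.Properties using (+-assoc; m≤m+n; ≤-trans; ≤-refl; n≤1+n)
open import Data.Fin using (Fin)
open import Data.Bool using (Bool; true; false)
open import Data.List
  using (List; []; _∷_; _++_; _∷ʳ_; _ʳ++_; length; map; reverse; initLast; _∷ʳ′_)
open import Data.List.Properties
  using (length-++; map-++; ++-assoc; ʳ++-defn; reverse-map; reverse-injective)
open import Data.Product using (Σ; ∃-syntax; _×_; _,_; proj₁; proj₂; swap)
open import Data.Sum using (_⊎_; inj₁; inj₂)
open import Data.Empty using (⊥-elim)
open import Relation.Nullary using (¬_)
open import Relation.Binary.PropositionalEquality
open import Function.Bundles using (_⇔_; mk⇔; Inverse; Equivalence)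
open import Function.Construct.Symmetry using (↔-sym; ⇔-sym)

reversePath : ∀ {P : Set} → List (P × P) → List (P × P)
reversePath w = map swap w ʳ++ []

module _ {P VL EL : Set} (X : Structure P VL EL) where
  open Structure X

  EdgeSymmetric : Set
  EdgeSymmetric = ∀ {u a v b} → E u a v b → E v b u a

  EdgeFunctional : Set
  EdgeFunctional = ∀ {u a v b v' b'} → E u a v b → E u a v' b' → (v ≡ v') × (b ≡ b')

  Follow-++ : ∀ {x y z v w} → Follow X x v y → Follow X y w z → Follow X x (v ++ w) z
  Follow-++ here       g = g
  Follow-++ (step e f) g = step e (Follow-++ f g)

  Follow-split : ∀ v {w x z} → Follow X x (v ++ w) z → ∃[ y ] (Follow X x v y × Follow X y w z)
  Follow-split []      f          = _ , here , f
  Follow-split (_ ∷ v) (step e f) with Follow-split v f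
  ... | y , f₁ , f₂ = y , step e f₁ , f₂

  Follow-snoc : ∀ {x y z w a b} → Follow X x w y → E y a z b → Follow X x (w ∷ʳ (a , b)) z
  Follow-snoc f e = Follow-++ f (step e here)

  Follow-unsnoc : ∀ w {x z a b} → Follow X x (w ∷ʳ (a , b)) z → ∃[ y ] (Follow X x w y × E y a z b)
  Follow-unsnoc w f with Follow-split w f
  ... | y , f₁ , step e here = y , f₁ , e

  Follow-deterministic : EdgeFunctional → ∀ {x w y y'} → Follow X x w y → Follow X x w y' → y ≡ y'
  Follow-deterministic fun here       here         = refl
  Follow-deterministic fun (step e f) (step e' f') with fun e e'
  ... | refl , refl = Follow-deterministic fun f f'

  Follow-reverse : EdgeSymmetric → ∀ {x y w} → Follow X x w y → Follow X y (reversePath w) x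
  Follow-reverse sym-E = go here
    where
    go : ∀ {x x' y w acc} → Follow X x acc x' → Follow X x w y → Follow X y (map swap w ʳ++ acc) x'
    go back here       = back
    go back (step e f) = go (step (sym-E e) back) f

  Follow-back : EdgeSymmetric → EdgeFunctional → ∀ w {x y z a b c} →
                Follow X x (w ∷ʳ (a , b)) y → E y b z c → Follow X x w z
  Follow-back sym-E fun w f e with Follow-unsnoc w f
  ... | y' , f' , e' with fun (sym-E e') e
  ... | refl , _ = f'

module _ {P VL EL : Set} {X Y : Pointed P VL EL} (φ : X ≅ Y) where
  open Pointed X renaming (S to SX; ptr to ptrX)
  open Pointed Y using () renaming (S to SY)
  open Structure SX using () renaming (V to VX)
  open Structure SY using () renaming (V to VY)
  open _≅_ φ using (f; bij; pres-E; pres-vlab; pres-elab; pres-ptr)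

  private
    g : VY → VX
    g = Inverse.from bij

    f∘g : ∀ y → f (g y) ≡ y
    f∘g = Inverse.strictlyInverseˡ bij

    reflect₂ : {R : VX → VX → Set} {R' : VY → VY → Set} →
               (∀ x x' → R x x' ⇔ R' (f x) (f x')) → ∀ y y' → R' y y' ⇔ R (g y) (g y')
    reflect₂ {R} {R'} pres y y' =
      ⇔-sym (subst₂ (λ u u' → R (g y) (g y') ⇔ R' u u') (f∘g y) (f∘g y') (pres (g y) (g y')))

  ≅-sym : Y ≅ X
  ≅-sym = record
    { bij       = ↔-sym bij
    ; pres-E    = λ y a y' b → reflect₂ (λ x x' → pres-E x a x' b) y y'
    ; pres-vlab = λ y σ → reflect₂ {λ x _ → Structure.vlab SX x σ} {λ y _ → Structure.vlab SY y σ}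
                                   (λ x _ → pres-vlab x σ) y y
    ; pres-elab = λ y a y' b δ → reflect₂ (λ x x' → pres-elab x a x' b δ) y y'
    ; pres-ptr  = trans (cong g (sym pres-ptr)) (Inverse.strictlyInverseʳ bij ptrX)
    }

snoc-length : ∀ {A : Set} (p : List A) x n → length (p ∷ʳ x) + n ≡ length p + suc n
snoc-length p x n = begin
  length (p ∷ʳ x) + n  ≡⟨ cong (_+ n) (length-++ p) ⟩
  length p + 1 + n     ≡⟨ +-assoc (length p) 1 n ⟩
  length p + suc n     ∎
  where open ≡-Reasoning

module DiskTransport {P VL EL : Set} {X Y : Pointed P VL EL} {r : ℕ} (φ : disk X r ≅ disk Y r) where
  open Pointed X renaming (S to SX; ptr to ptrX)
  open Pointed Y renaming (S to SY; ptr to ptrY)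
  open _≅_ φ using (f; pres-E; pres-vlab; pres-ptr)

  DiskVertex : Set
  DiskVertex = Σ (Structure.V SX) (Within X (suc r))

  transport-from : (x̃ : DiskVertex) → ∀ {w z} → Follow SX (proj₁ x̃) w z →
                   length (proj₁ (proj₂ x̃)) + length w ≤ suc r →
                   Σ DiskVertex λ z̃ → proj₁ z̃ ≡ z × Follow SY (proj₁ (f x̃)) w (proj₁ (f z̃))
  transport-from x̃ here _ = x̃ , refl , here
  transport-from x̃@(_ , p , _ , fp) {(a , b) ∷ w} (step {y = y} e fw) bound
    with transport-from ỹ fw bound'
    where
    bound' : length (p ∷ʳ (a , b)) + length w ≤ suc r
    bound' = subst (_≤ suc r) (sym (snoc-length p (a , b) (length w))) bound
    ỹ : DiskVertex
    ỹ = y , p ∷ʳ (a , b) , ≤-trans (m≤m+n _ (length w)) bound' , Follow-snoc SX fp e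
  ... | z̃ , eq , fz = z̃ , eq , step (Equivalence.to (pres-E x̃ a _ b) e) fz

  transport : ∀ {w z} → Follow SX ptrX w z → length w ≤ suc r →
              Σ DiskVertex λ z̃ → proj₁ z̃ ≡ z × Follow SY ptrY w (proj₁ (f z̃))
  transport {w} fw bound with transport-from (Pointed.ptr (disk X r)) fw bound
  ... | z̃ , eq , fz = z̃ , eq , subst (λ u → Follow SY u w (proj₁ (f z̃))) (cong proj₁ pres-ptr) fz

  path-transport : ∀ {w z} → Follow SX ptrX w z → length w ≤ suc r → ∃[ z' ] Follow SY ptrY w z'
  path-transport fw bound with transport fw bound
  ... | z̃ , _ , fz = _ , fz

  label-transport : ∀ {w z σ} → Follow SX ptrX w z → length w ≤ r → Structure.vlab SX z σ →
                    ∃[ z' ] (Follow SY ptrY w z' × Structure.vlab SY z' σ)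
  label-transport {w} {σ = σ} fw bound lab with transport fw (≤-trans bound (n≤1+n _))
  ... | z̃ , refl , fz = _ , fz , proj₁ (Equivalence.to (pres-vlab z̃ σ) (lab , w , bound , fw))

data IsChildPort {n : ℕ} : Bool → Port' n → Set where
  left  : IsChildPort false (inj₂ pl)
  right : IsChildPort true (inj₂ pr)

child-port : ∀ {n} c → ∃[ a ] IsChildPort {n} c a
child-port false = _ , left
child-port true  = _ , right

treeWord-snoc : ∀ {n} t {c a} → IsChildPort {n} c a → treeWord (t ∷ʳ c) ≡ treeWord t ∷ʳ (a , inj₂ pm)
treeWord-snoc t left  = map-++ _ t (false ∷ [])
treeWord-snoc t right = map-++ _ t (true ∷ [])

normal-form-snoc : ∀ {n} u t {c a} → IsChildPort {n} c a →
                   liftΠ u ++ bullet ∷ treeWord (t ∷ʳ c) ≡ (liftΠ u ++ bullet ∷ treeWord t) ∷ʳ (a , inj₂ pm)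
normal-form-snoc u t p = begin
  liftΠ u ++ bullet ∷ treeWord (t ∷ʳ _)                ≡⟨ cong (λ τ → liftΠ u ++ bullet ∷ τ) (treeWord-snoc t p) ⟩
  liftΠ u ++ bullet ∷ treeWord t ∷ʳ _                  ≡⟨ ++-assoc (liftΠ u) (bullet ∷ treeWord t) _ ⟨
  (liftΠ u ++ bullet ∷ treeWord t) ∷ʳ _                ∎
  where open ≡-Reasoning

-- The word climbing from the tree vertex of word v to the attachment point.
upWord : ∀ {n} → List Bool → List (Port' n × Port' n)
upWord v = map swap (treeWord v) ++ bullet ∷ []

reverse-bullet-path : ∀ {n} t → reversePath {Port' n} (bullet ∷ treeWord t) ≡ upWord (reverse t)
reverse-bullet-path t = begin
  map swap (treeWord t) ʳ++ bullet ∷ []              ≡⟨ ʳ++-defn (map swap (treeWord t)) ⟩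
  reverse (map swap (treeWord t)) ++ bullet ∷ []     ≡⟨ cong (_++ _) (reverse-map swap (treeWord t)) ⟨
  map swap (reverse (treeWord t)) ++ bullet ∷ []     ≡⟨ cong (λ τ → map swap τ ++ _) (reverse-map _ t) ⟨
  map swap (treeWord (reverse t)) ++ bullet ∷ []     ∎
  where open ≡-Reasoning

module Attached {nπ nΣ nΔ : ℕ} (G : Structure (Fin nπ) (Fin nΣ) (Fin nΔ)) where
  open Structure G using (V)

  A : Structure (Port' nπ) (VL' nΣ) (Fin nΔ)
  A = attach G

  data TreeEdge (x : V) : List Bool → Port' nπ → AV G → Port' nπ → Set where
    toChild  : ∀ {w c a} → IsChildPort c a → TreeEdge x w a (inj₂ (x , c ∷ w)) (inj₂ pm)
    toRoot   : TreeEdge x [] (inj₂ pm) (inj₁ x) (inj₂ pm)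
    toParent : ∀ {w c b} → IsChildPort c b → TreeEdge x (c ∷ w) (inj₂ pm) (inj₂ (x , w)) b

  tree-edge : ∀ {x w a z b} → AE G (inj₂ (x , w)) a z b → TreeEdge x w a z b
  tree-edge root←          = toRoot
  tree-edge (child→ false) = toChild left
  tree-edge (child→ true)  = toChild right
  tree-edge (child← false) = toParent left
  tree-edge (child← true)  = toParent right

  lift-stays-in-base : ∀ {x z} u → Follow A (inj₁ x) (liftΠ u) z → ∃[ x' ] (z ≡ inj₁ x')
  lift-stays-in-base []      here              = _ , refl
  lift-stays-in-base (_ ∷ u) (step (base _) f) = lift-stays-in-base u f

  drop-lift : ∀ {x w z} u → Follow A (inj₁ x) (liftΠ u ++ w) z → ∃[ x' ] Follow A (inj₁ x') w z
  drop-lift []      f                 = _ , f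
  drop-lift (_ ∷ u) (step (base _) f) = drop-lift u f

  descend : ∀ {x w z} t → Follow A (inj₂ (x , w)) (treeWord t) z → z ≡ inj₂ (x , t ʳ++ w)
  descend []          here       = refl
  descend (false ∷ t) (step e f) with tree-edge e
  ... | toChild left = descend t f
  descend (true ∷ t)  (step e f) with tree-edge e
  ... | toChild right = descend t f

  descend-path : ∀ {x} t w → Follow A (inj₂ (x , w)) (treeWord t) (inj₂ (x , t ʳ++ w))
  descend-path []          w = here
  descend-path (false ∷ t) w = step (child→ false) (descend-path t (false ∷ w))
  descend-path (true ∷ t)  w = step (child→ true) (descend-path t (true ∷ w))

  bullet-descends : ∀ {x z} s → Follow A (inj₁ x) (bullet ∷ treeWord s) z → z ≡ inj₂ (x , reverse s)
  bullet-descends s (step root→ f) = descend s f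

  bullet-path : ∀ {x} s → Follow A (inj₁ x) (bullet ∷ treeWord s) (inj₂ (x , reverse s))
  bullet-path s = step root→ (descend-path s [])

  normal-form-in-tree : ∀ {x z} u t → Follow A (inj₁ x) (liftΠ u ++ bullet ∷ treeWord t) z →
                        ∃[ x' ] ∃[ w ] (z ≡ inj₂ (x' , w))
  normal-form-in-tree u t f with drop-lift u f
  ... | x' , f' = x' , reverse t , bullet-descends t f'

  ascend : ∀ {x w z} v → Follow A (inj₂ (x , w)) (upWord v) z → w ≡ v
  ascend []          (step e _) with tree-edge e
  ... | toRoot     = refl
  ... | toChild ()
  ... | toParent ()
  ascend (false ∷ v) (step e f) with tree-edge e
  ... | toParent left = cong (false ∷_) (ascend v f)
  ascend (true ∷ v)  (step e f) with tree-edge e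
  ... | toParent right = cong (true ∷_) (ascend v f)

module Closure {nπ nΣ nΔ : ℕ} (Y' : X' nπ nΣ nΔ) (isG : IsGraphP Y') (yb : InYbar Y')
               (visible : ¬ Structure.vlab (Pointed.S Y') (Pointed.ptr Y') mLabel) where
  open Pointed Y'
  open Structure S
  open IsGraph isG
  open DiskTransport using (path-transport; label-transport)

  Base : Set₁
  Base = Structure (Fin nπ) (Fin nΣ) (Fin nΔ)

  attachedAt : (G : Base) → Structure.V G → X' nπ nΣ nΔ
  attachedAt G x = record { S = attach G ; ptr = inj₁ x }

  -- every disk of Y' is a disk of an attached graph pointed at a base
  -- vertex: a tree vertex is labelled m, and the pointer of Y' is not
  local-view : ∀ r → Σ Base λ G → Σ (Structure.V G) λ x → disk (attachedAt G x) r ≅ disk Y' r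
  local-view r with yb r
  ... | (G , _) , inj₁ x , φ = G , x , φ
  ... | _ , inj₂ _ , φ with label-transport φ here z≤n treeL
  ...   | _ , here , lab = ⊥-elim (visible lab)

  pull-path : ∀ {w v} → Follow S ptr w v → Σ Base λ G → Σ (Structure.V G) λ x → ∃[ z ] Follow (attach G) (inj₁ x) w z
  pull-path {w} fw with local-view (length w)
  ... | G , x , φ = G , x , path-transport (≅-sym φ) fw (n≤1+n _)

  pull-edge : ∀ {w y a z b} → Follow S ptr w y → E y a z b →
              Σ Base λ G → Σ (Structure.V G) λ x → ∃[ y' ] ∃[ z' ] (Follow (attach G) (inj₁ x) w y' × AE G y' a z' b)
  pull-edge {w} fy e with pull-path (Follow-snoc S fy e)
  ... | G , x , _ , fz with Follow-unsnoc (attach G) w fz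
  ... | y' , fy' , e' = G , x , y' , _ , fy' , e'

  NormalForm : V → Set
  NormalForm v = (∃[ u ] Follow S ptr (liftΠ u) v)
               ⊎ (∃[ u ] ∃[ t ] Follow S ptr (liftΠ u ++ bullet ∷ treeWord t) v)

  reach : ∀ {w w' v} → w ≡ w' → Follow S ptr w v → Follow S ptr w' v
  reach eq = subst (λ w → Follow S ptr w _) eq

  parent-step : ∀ u t {y z b} → Follow S ptr (liftΠ u ++ bullet ∷ treeWord t) y → E y (inj₂ pm) z b → NormalForm z
  parent-step u t fy e with initLast t
  ... | []       = inj₁ (u , Follow-back S E-sym E-fun (liftΠ u) fy e)
  ... | t' ∷ʳ′ c with child-port c
  ...   | _ , p = inj₂ (u , t' , Follow-back S E-sym E-fun _ (reach (normal-form-snoc u t' p) fy) e)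

  -- normal forms are closed under taking neighbours: the last edge of the
  -- path is classified in an attached graph
  normal-form-step : ∀ {y a z b} → NormalForm y → E y a z b → NormalForm z
  normal-form-step (inj₁ (u , fy)) e with pull-edge fy e
  ... | G , _ , _ , _ , fy' , e' with Attached.lift-stays-in-base G u fy'
  ... | _ , refl with e'
  ...   | base _ = inj₁ (u ∷ʳ _ , reach (sym (map-++ _ u _)) (Follow-snoc S fy e))
  ...   | root→  = inj₂ (u , [] , Follow-snoc S fy e)
  normal-form-step (inj₂ (u , t , fy)) e with pull-edge fy e
  ... | G , _ , _ , _ , fy' , e' with Attached.normal-form-in-tree G u t fy'
  ... | _ , _ , refl with Attached.tree-edge G e'
  ...   | Attached.toChild p  = inj₂ (u , t ∷ʳ _ , reach (sym (normal-form-snoc u t p)) (Follow-snoc S fy e))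
  ...   | Attached.toRoot     = parent-step u t fy e
  ...   | Attached.toParent _ = parent-step u t fy e

  every-vertex-normal : ∀ v → NormalForm v
  every-vertex-normal v = along (inj₁ ([] , here)) (proj₂ (connected ptr v))
    where
    along : ∀ {x w v} → NormalForm x → Follow S x w v → NormalForm v
    along nf here       = nf
    along nf (step e f) = along (normal-form-step nf e) f

  -- claim 2: u•t reaches a tree vertex of an attached graph, which is
  -- labelled m, and so is its counterpart in Y'
  tree-part-invisible : ∀ u t v → Follow S ptr (liftΠ u ++ bullet ∷ treeWord t) v → vlab v mLabel
  tree-part-invisible u t v fv with local-view (length (liftΠ u ++ bullet ∷ treeWord t))
  ... | G , _ , φ with path-transport (≅-sym φ) fv (n≤1+n _)
  ... | _ , fz with Attached.normal-form-in-tree G u t fz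
  ... | _ , _ , refl with label-transport φ fz ≤-refl treeL
  ... | _ , fv' , lab = subst (λ y → vlab y mLabel) (Follow-deterministic S E-fun fv' fv) lab

  -- claim 3: •s is a path in every attached graph, hence in Y'
  bullet-paths-exist : ∀ s → ∃[ x ] Follow S ptr (bullet ∷ treeWord s) x
  bullet-paths-exist s with local-view (length (bullet {nπ} ∷ treeWord s))
  ... | G , _ , φ = path-transport φ (Attached.bullet-path G s) (n≤1+n _)

  -- claim 4: if •s and •t meet, •s followed by the reversal of •t is a path
  -- of an attached graph, which forces reverse s ≡ reverse t
  bullet-paths-separate : ∀ s t {x} → Follow S ptr (bullet ∷ treeWord s) x → Follow S ptr (bullet ∷ treeWord t) x → s ≡ t
  bullet-paths-separate s t fs ft with pull-path (Follow-++ S fs (Follow-reverse S E-sym ft))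
  ... | G , _ , _ , f with Follow-split (attach G) (bullet ∷ treeWord s) f
  ... | _ , fs' , back with Attached.bullet-descends G s fs'
  ... | refl = reverse-injective
                 (Attached.ascend G (reverse t) (subst (λ w → Follow (attach G) _ w _) (reverse-bullet-path t) back))

  bullet-paths-injective : ∀ s t x y → Follow S ptr (bullet ∷ treeWord s) x → Follow S ptr (bullet ∷ treeWord t) y →
                           (x ≡ y) ⇔ (s ≡ t)
  bullet-paths-injective s t x y fs ft =
    mk⇔ (λ { refl → bullet-paths-separate s t fs ft }) (λ { refl → Follow-deterministic S E-fun fs ft })

lemma1 : ∀ {nπ nΣ nΔ : ℕ} (Y' : X' nπ nΣ nΔ) → IsGraphP Y' → InYbar Y'
  → ¬ Structure.vlab (Pointed.S Y') (Pointed.ptr Y') mLabel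
  → (∀ (v : Structure.V (Pointed.S Y'))
       → (∃[ u ] Follow (Pointed.S Y') (Pointed.ptr Y') (liftΠ u) v)
         ⊎ (∃[ u ] ∃[ t ] Follow (Pointed.S Y') (Pointed.ptr Y') (liftΠ u ++ bullet ∷ treeWord t) v))
    × (∀ (u : List (Fin nπ × Fin nπ)) (t : List Bool) (v : Structure.V (Pointed.S Y'))
       → Follow (Pointed.S Y') (Pointed.ptr Y') (liftΠ u ++ bullet ∷ treeWord t) v
       → Structure.vlab (Pointed.S Y') v mLabel)
    × (∀ (s : List Bool) → ∃[ x ] Follow (Pointed.S Y') (Pointed.ptr Y') (bullet ∷ treeWord s) x)
    × (∀ (s t : List Bool) (x y : Structure.V (Pointed.S Y'))
       → Follow (Pointed.S Y') (Pointed.ptr Y') (bullet ∷ treeWord s) x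
       → Follow (Pointed.S Y') (Pointed.ptr Y') (bullet ∷ treeWord t) y
       → (x ≡ y) ⇔ (s ≡ t))
lemma1 Y' isG yb visible =
  every-vertex-normal , tree-part-invisible , bullet-paths-exist , bullet-paths-injective
  where open Closure Y' isG yb visible
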